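{- In the setting of the context, $K^*_{\mathrm{DRR}}$ is a feasible double round-robin schedule: in every slot $0,\dots,2n-3$ each team plays exactly one game, the opponent and home/away assignments are consistent (if $t$ plays $t'$ in a slot then $t'$ plays $t$ in that slot, and exactly one of them plays at home), and every ordered pair of distinct teams (team $i$ playing at the home venue of team $j$) occurs exactly once.
   Context: Teams are $T=\{0,1,\dots,n-1\}$ with $n\ge4$ even. For $t\in T$ and $s\in\{0,\dots,n-2\}$ define $K^*(t,s)=s-t\pmod{n-1}$ if $t\ne n-1$ and $s-t\not\equiv t\pmod{n-1}$; $K^*(t,s)=n-1$ if $t\ne n-1$ and $s-t\equiv t\pmod{n-1}$; $K^*(n-1,s)=s/2$ if $s$ is even; $K^*(n-1,s)=(s+n-1)/2$ if $s$ is odd. The schedule $K^*_{\mathrm{DRR}}$ has slots $0,\dots,2n-3$: in slots $s$ and $s+n-1$ ($0\le s\le n-2$) team $t$ plays against $K^*(t,s)$. Home/away: for $t\in\{0,\dots,n/2-1\}$ the games of $t$ in slots $2t,2t+1,\dots,n+2t-2$ are home games and the others are away games; for $t\in\{n/2,\dots,n-2\}$ the games in slots $2t-n+2,\dots,2t$ are away games and the others home games; for team $n-1$ the games in slots $0,\dots,n-2$ are away and the others home. -}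

module Defs where

open import Data.Nat using (ℕ; zero; suc; _+_; _*_; _∸_; _≤_; _<_; _≤?_; _<?_; _≟_)
open import Data.Nat.DivMod using (_%_; _/_)
open import Data.Bool using (Bool; true; false; not; _∧_; if_then_else_)
open import Relation.Nullary.Decidable using (⌊_⌋)

-- Teams are 0,…,n-1, slots 0,…,2n-3 (as natural numbers; bounds are
-- imposed in the statement).  All definitions below are intended for
-- n ≥ 2, where n - 1 = suc (n ∸ 2), which provides a nonzero modulus.

modN₁ : ℕ → ℕ → ℕ
modN₁ n x = x % suc (n ∸ 2)

Kstar : ℕ → ℕ → ℕ → ℕ
Kstar n t s =
  if ⌊ t ≟ n ∸ 1 ⌋
  then (if ⌊ s % 2 ≟ 0 ⌋ then s / 2 else (s + (n ∸ 1)) / 2)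
  else (if ⌊ modN₁ n (s + (n ∸ 1) ∸ t) ≟ modN₁ n t ⌋
        then n ∸ 1
        else modN₁ n (s + (n ∸ 1) ∸ t))
-- Here s + (n-1) - t ≡ s - t (mod n-1) (note t ≤ n-2 in that branch),
-- and t mod (n-1) = t for t ≤ n-2.

-- Opponent of team t in slot s ∈ {0,…,2n-3} of K*_DRR:
-- slots s and s+n-1 both use K*(t,s).
opp : ℕ → ℕ → ℕ → ℕ
opp n t s = if ⌊ s <? n ∸ 1 ⌋ then Kstar n t s else Kstar n t (s ∸ (n ∸ 1))

home : ℕ → ℕ → ℕ → Bool
home n t s =
  if ⌊ t <? n / 2 ⌋
  then (⌊ 2 * t ≤? s ⌋ ∧ ⌊ s ≤? n + 2 * t ∸ 2 ⌋)
  else (if ⌊ t ≟ n ∸ 1 ⌋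
        then ⌊ n ∸ 1 ≤? s ⌋
        else not (⌊ 2 * t + 2 ∸ n ≤? s ⌋ ∧ ⌊ s ≤? 2 * t ⌋))

module Submission where

-- Write n = 2k + 2 and m = n - 1 = 2k + 1 (odd).  Teams 0, …, m-1 sit on a
-- rim, team m in the centre.  In a first-half slot s < m two rim teams t ≠ o
-- meet iff t + o ≡ s (mod m), and the centre meets the rim team t with
-- 2t ≡ s (mod m); we call this relation Meet.  Since m is odd, Meet s is a
-- perfect matching for every s, and every pair of teams meets in exactly one
-- first-half slot.  Slot s + m repeats slot s.
--
-- For home/away, a rim team t is away in a first-half slot s iff
-- s < 2t < s + m, the centre is always away, and in the second half every
-- home/away assignment is flipped.  From this, exactly one team of each
-- meeting plays at home, and of the two slots s, s + m in which i meets j,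
-- j hosts in exactly one.

open import Defs
open import Data.Nat using (ℕ; zero; suc; _+_; _*_; _∸_; _≤_; _<_; s≤s; s≤s⁻¹; NonZero; _≤?_; _<?_; _≟_)
open import Data.Nat.Properties
open import Data.Nat.DivMod using (_%_; _/_; m%n<n; m<n⇒m%n≡m; [m+n]%n≡m%n; m*n%n≡0; [m+kn]%n≡m%n; m*n/n≡m)
open import Data.Nat.Divisibility using (_∣_; divides)
open import Data.Nat.Tactic.RingSolver using (solve-∀)
open import Data.Bool using (Bool; true; false; not; _∧_; if_then_else_)
open import Data.Bool.Properties using (not-injective; not-involutive; ∧-identityʳ)
open import Data.Product using (_×_; _,_; proj₁; proj₂; ∃-syntax)
open import Data.Sum using (_⊎_; inj₁; inj₂)
open import Data.Empty using (⊥-elim)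
open import Relation.Nullary using (Dec; yes; no; ¬_)
open import Relation.Nullary.Decidable using (⌊_⌋; isYes≗does; dec-true; dec-false; _×-dec_)
open import Relation.Binary.Definitions using (tri<; tri≈; tri>)
open import Relation.Binary.PropositionalEquality

⌊⌋-true : ∀ {P : Set} (d : Dec P) → P → ⌊ d ⌋ ≡ true
⌊⌋-true d p = trans (isYes≗does d) (dec-true d p)

⌊⌋-false : ∀ {P : Set} (d : Dec P) → ¬ P → ⌊ d ⌋ ≡ false
⌊⌋-false d ¬p = trans (isYes≗does d) (dec-false d ¬p)

⌊⌋-iff : ∀ {P Q : Set} (p? : Dec P) (q? : Dec Q) → (P → Q) → (Q → P) → ⌊ p? ⌋ ≡ ⌊ q? ⌋
⌊⌋-iff p? (yes q) _ Q⇒P = ⌊⌋-true p? (Q⇒P q)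
⌊⌋-iff p? (no ¬q) P⇒Q _ = ⌊⌋-false p? (λ p → ¬q (P⇒Q p))

⌊⌋-complement : ∀ {P Q : Set} (p? : Dec P) (q? : Dec Q) → (P → ¬ Q) → (¬ Q → P) → ⌊ p? ⌋ ≡ not ⌊ q? ⌋
⌊⌋-complement p? (yes q) P⇒¬Q _ = ⌊⌋-false p? (λ p → P⇒¬Q p q)
⌊⌋-complement p? (no ¬q) _ ¬Q⇒P = ⌊⌋-true p? (¬Q⇒P ¬q)

if-true : ∀ {A : Set} {b : Bool} {x y : A} → b ≡ true → (if b then x else y) ≡ x
if-true refl = refl

if-false : ∀ {A : Set} {b : Bool} {x y : A} → b ≡ false → (if b then x else y) ≡ y
if-false refl = refl

opposite : ∀ {a b : Bool} → a ≡ true → b ≡ false → a ≢ b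
opposite refl refl ()

-- `Reduces m x s`: x is s or s + m, i.e. (for x < 2m, s < m) s = x mod m.
Reduces : ℕ → ℕ → ℕ → Set
Reduces m x s = x ≡ s ⊎ x ≡ s + m

reduces-exists : ∀ {m x} → x < m + m → ∃[ s ] (s < m × Reduces m x s)
reduces-exists {m} {x} x<2m with x <? m
... | yes x<m = x , x<m , inj₁ refl
... | no x≮m = x ∸ m , x∸m<m , inj₂ (sym (m∸n+n≡m (≮⇒≥ x≮m)))
  where
  x∸m<m : x ∸ m < m
  x∸m<m = +-cancelʳ-< m (x ∸ m) m (subst (_< m + m) (sym (m∸n+n≡m (≮⇒≥ x≮m))) x<2m)

reduces-bound : ∀ {m x s} → s < m → Reduces m x s → x < m + m
reduces-bound {m} s<m (inj₁ refl) = <-≤-trans s<m (m≤m+n m m)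
reduces-bound {m} s<m (inj₂ refl) = +-monoˡ-< m s<m

reduces-unique : ∀ {m x s₁ s₂} → s₁ < m → s₂ < m → Reduces m x s₁ → Reduces m x s₂ → s₁ ≡ s₂
reduces-unique _ _ (inj₁ e₁) (inj₁ e₂) = trans (sym e₁) e₂
reduces-unique {m} _ _ (inj₂ e₁) (inj₂ e₂) = +-cancelʳ-≡ m _ _ (trans (sym e₁) e₂)
reduces-unique {m} {s₂ = s₂} s₁<m _ (inj₁ e₁) (inj₂ e₂) =
  ⊥-elim (<⇒≱ s₁<m (subst (m ≤_) (trans (sym e₂) e₁) (m≤n+m m s₂)))
reduces-unique {m} {s₁ = s₁} _ s₂<m (inj₂ e₁) (inj₁ e₂) =
  ⊥-elim (<⇒≱ s₂<m (subst (m ≤_) (trans (sym e₁) e₂) (m≤n+m m s₁)))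

reduces-cancelˡ : ∀ {m a x y s} → x < m → y < m → Reduces m (a + x) s → Reduces m (a + y) s → x ≡ y
reduces-cancelˡ {a = a} _ _ (inj₁ e₁) (inj₁ e₂) = +-cancelˡ-≡ a _ _ (trans e₁ (sym e₂))
reduces-cancelˡ {a = a} _ _ (inj₂ e₁) (inj₂ e₂) = +-cancelˡ-≡ a _ _ (trans e₁ (sym e₂))
reduces-cancelˡ {m} {a} {x} {y} {s} _ y<m (inj₁ e₁) (inj₂ e₂) = ⊥-elim (<⇒≱ y<m m≤y)
  where
  m≤y : m ≤ y
  m≤y = subst (m ≤_) (sym (+-cancelˡ-≡ a y (x + m) (trans e₂ (trans (cong (_+ m) (sym e₁)) (+-assoc a x m)))))
                     (m≤n+m m x)
reduces-cancelˡ {m} {a} {x} {y} {s} x<m _ (inj₂ e₁) (inj₁ e₂) = ⊥-elim (<⇒≱ x<m m≤x)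
  where
  m≤x : m ≤ x
  m≤x = subst (m ≤_) (sym (+-cancelˡ-≡ a x (y + m) (trans e₁ (trans (cong (_+ m) (sym e₂)) (+-assoc a y m)))))
                     (m≤n+m m y)

double : ∀ t → 2 * t ≡ t + t
double t = cong (t +_) (+-identityʳ t)

even≢even+odd : ∀ k x y → y + y ≢ x + x + suc (k + k)
even≢even+odd k x y e = even≢odd y (x + k) (trans (double y) (trans e (odd-sum x k)))
  where
  odd-sum : ∀ x k → x + x + suc (k + k) ≡ suc (2 * (x + k))
  odd-sum = solve-∀

reduces-halve : ∀ {k x y s} → Reduces (suc (k + k)) (x + x) s → Reduces (suc (k + k)) (y + y) s → x ≡ y
reduces-halve {x = x} {y} (inj₁ e₁) (inj₁ e₂) = *-cancelˡ-≡ x y 2 (trans (double x) (trans (trans e₁ (sym e₂)) (sym (double y))))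
reduces-halve {x = x} {y} (inj₂ e₁) (inj₂ e₂) = *-cancelˡ-≡ x y 2 (trans (double x) (trans (trans e₁ (sym e₂)) (sym (double y))))
reduces-halve {k} {x} {y} (inj₁ e₁) (inj₂ e₂) = ⊥-elim (even≢even+odd k x y (trans e₂ (cong (_+ suc (k + k)) (sym e₁))))
reduces-halve {k} {x} {y} (inj₂ e₁) (inj₁ e₂) = ⊥-elim (even≢even+odd k y x (trans e₁ (cong (_+ suc (k + k)) (sym e₂))))

-- For t, s < m the team t + ((s - t) mod m), computed without negative numbers,
-- adds up with t to s modulo m.
rim-partner : ∀ {m t s} .{{_ : NonZero m}} → t < m → s < m → Reduces m (t + (s + m ∸ t) % m) s
rim-partner {m} {t} {s} t<m s<m with t ≤? s
... | yes t≤s = inj₁ (trans (cong (t +_) r≡s∸t) (m+[n∸m]≡n t≤s))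
  where
  r≡s∸t : (s + m ∸ t) % m ≡ s ∸ t
  r≡s∸t = trans (cong (_% m) (+-∸-comm m t≤s))
         (trans ([m+n]%n≡m%n (s ∸ t) m) (m<n⇒m%n≡m (≤-<-trans (m∸n≤m s t) s<m)))
... | no t≰s = inj₂ (trans (cong (t +_) r≡s+m∸t) (m+[n∸m]≡n t≤s+m))
  where
  t≤s+m : t ≤ s + m
  t≤s+m = ≤-trans (<⇒≤ t<m) (m≤n+m m s)
  r≡s+m∸t : (s + m ∸ t) % m ≡ s + m ∸ t
  r≡s+m∸t = m<n⇒m%n≡m (subst (s + m ∸ t <_) (m+n∸m≡n s m) (∸-monoʳ-< (≰⇒> t≰s) t≤s+m))

-- Conversions to the form q * 2 used by the division lemmas of the library.
q+q≡q*2 : ∀ q → q + q ≡ q * 2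
q+q≡q*2 q = trans (sym (double q)) (*-comm 2 q)

-- Sums used to halve odd slots: (2q + 1) + (2k + 1) = 2 (q + k + 1).
odd-sum : ∀ q k → suc (q + q) + suc (k + k) ≡ suc (q + k) * 2
odd-sum = solve-∀

centre-sum : ∀ q k → suc (q + k) + suc (q + k) ≡ suc (q + q) + suc (k + k)
centre-sum = solve-∀

data Halves : ℕ → Set where
  even : ∀ q → Halves (q + q)
  odd  : ∀ q → Halves (suc (q + q))

halves : ∀ s → Halves s
halves zero = even 0
halves (suc s) with halves s
... | even q = odd q
... | odd q = subst Halves (cong suc (+-suc q q)) (even (suc q))

module Circle (k : ℕ) where

  m : ℕ
  m = suc (k + k)

  n : ℕ
  n = suc m

  data Meet (s : ℕ) : ℕ → ℕ → Set where
    rim        : ∀ {t o} → t < m → o < m → o ≢ t → Reduces m (t + o) s → Meet s t o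
    toCentre   : ∀ {t} → t < m → Reduces m (t + t) s → Meet s t m
    fromCentre : ∀ {o} → o < m → Reduces m (o + o) s → Meet s m o

  team-view : ∀ {t} → t < n → t < m ⊎ t ≡ m
  team-view t<n = m≤n⇒m<n∨m≡n (s≤s⁻¹ t<n)

  meet-sym : ∀ {s t o} → Meet s t o → Meet s o t
  meet-sym {s} {t} {o} (rim t<m o<m o≢t h) = rim o<m t<m (≢-sym o≢t) (subst (λ x → Reduces m x s) (+-comm t o) h)
  meet-sym (toCentre t<m h) = fromCentre t<m h
  meet-sym (fromCentre o<m h) = toCentre o<m h

  meet-irrefl : ∀ {s t o} → Meet s t o → o ≢ t
  meet-irrefl (rim _ _ o≢t _) = o≢t
  meet-irrefl (toCentre t<m _) m≡t = <⇒≢ t<m (sym m≡t)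
  meet-irrefl (fromCentre o<m _) = <⇒≢ o<m

  meet-bound : ∀ {s t o} → Meet s t o → o < n
  meet-bound (rim _ o<m _ _) = m<n⇒m<1+n o<m
  meet-bound (toCentre _ _) = ≤-refl
  meet-bound (fromCentre o<m _) = m<n⇒m<1+n o<m

  meet-functional : ∀ {s t o₁ o₂} → Meet s t o₁ → Meet s t o₂ → o₁ ≡ o₂
  meet-functional (rim _ o₁<m _ h₁) (rim _ o₂<m _ h₂) = reduces-cancelˡ o₁<m o₂<m h₁ h₂
  meet-functional (rim t<m o₁<m o₁≢t h₁) (toCentre _ h₂) = ⊥-elim (o₁≢t (reduces-cancelˡ o₁<m t<m h₁ h₂))
  meet-functional (toCentre t<m h₁) (rim _ o₂<m o₂≢t h₂) = ⊥-elim (o₂≢t (reduces-cancelˡ o₂<m t<m h₂ h₁))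
  meet-functional (toCentre _ _) (toCentre _ _) = refl
  meet-functional (fromCentre _ h₁) (fromCentre _ h₂) = reduces-halve {k} h₁ h₂
  meet-functional (rim m<m _ _ _) (fromCentre _ _) = ⊥-elim (n≮n m m<m)
  meet-functional (toCentre m<m _) (fromCentre _ _) = ⊥-elim (n≮n m m<m)
  meet-functional (fromCentre _ _) (rim m<m _ _ _) = ⊥-elim (n≮n m m<m)
  meet-functional (fromCentre _ _) (toCentre m<m _) = ⊥-elim (n≮n m m<m)

  meet-slot-unique : ∀ {s₁ s₂ t o} → s₁ < m → s₂ < m → Meet s₁ t o → Meet s₂ t o → s₁ ≡ s₂
  meet-slot-unique s₁<m s₂<m (rim _ _ _ h₁) (rim _ _ _ h₂) = reduces-unique s₁<m s₂<m h₁ h₂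
  meet-slot-unique s₁<m s₂<m (toCentre _ h₁) (toCentre _ h₂) = reduces-unique s₁<m s₂<m h₁ h₂
  meet-slot-unique s₁<m s₂<m (fromCentre _ h₁) (fromCentre _ h₂) = reduces-unique s₁<m s₂<m h₁ h₂
  meet-slot-unique _ _ (rim _ m<m _ _) (toCentre _ _) = ⊥-elim (n≮n m m<m)
  meet-slot-unique _ _ (toCentre _ _) (rim _ m<m _ _) = ⊥-elim (n≮n m m<m)
  meet-slot-unique _ _ (rim m<m _ _ _) (fromCentre _ _) = ⊥-elim (n≮n m m<m)
  meet-slot-unique _ _ (fromCentre _ _) (rim m<m _ _ _) = ⊥-elim (n≮n m m<m)
  meet-slot-unique _ _ (toCentre m<m _) (fromCentre _ _) = ⊥-elim (n≮n m m<m)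
  meet-slot-unique _ _ (fromCentre _ _) (toCentre m<m _) = ⊥-elim (n≮n m m<m)

  meet-exists : ∀ {i j} → i < n → j < n → i ≢ j → ∃[ s ] (s < m × Meet s i j)
  meet-exists {i} {j} i<n j<n i≢j with team-view i<n | team-view j<n
  ... | inj₁ i<m | inj₁ j<m with reduces-exists (+-mono-< i<m j<m)
  ...   | s , s<m , h = s , s<m , rim i<m j<m (≢-sym i≢j) h
  meet-exists i<n j<n i≢j | inj₁ i<m | inj₂ refl with reduces-exists (+-mono-< i<m i<m)
  ...   | s , s<m , h = s , s<m , toCentre i<m h
  meet-exists i<n j<n i≢j | inj₂ refl | inj₁ j<m with reduces-exists (+-mono-< j<m j<m)
  ...   | s , s<m , h = s , s<m , fromCentre j<m h
  meet-exists i<n j<n i≢j | inj₂ refl | inj₂ refl = ⊥-elim (i≢j refl)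

  kstar-rim : ∀ {t s} → t < m →
    Kstar n t s ≡ (if ⌊ (s + m ∸ t) % m ≟ t ⌋ then m else (s + m ∸ t) % m)
  kstar-rim {t} {s} t<m =
    trans (if-false (⌊⌋-false (t ≟ m) (<⇒≢ t<m)))
          (cong (λ z → if ⌊ (s + m ∸ t) % m ≟ z ⌋ then m else (s + m ∸ t) % m) (m<n⇒m%n≡m t<m))

  kstar-centre-even : ∀ q → Kstar n m (q + q) ≡ q
  kstar-centre-even q =
    trans (if-true (⌊⌋-true (m ≟ m) refl))
    (trans (if-true (⌊⌋-true ((q + q) % 2 ≟ 0) (trans (cong (_% 2) (q+q≡q*2 q)) (m*n%n≡0 q 2))))
           (trans (cong (_/ 2) (q+q≡q*2 q)) (m*n/n≡m q 2)))

  kstar-centre-odd : ∀ q → Kstar n m (suc (q + q)) ≡ suc (q + k)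
  kstar-centre-odd q =
    trans (if-true (⌊⌋-true (m ≟ m) refl))
    (trans (if-false (⌊⌋-false (suc (q + q) % 2 ≟ 0) remainder≢0))
           (trans (cong (_/ 2) (odd-sum q k)) (m*n/n≡m (suc (q + k)) 2)))
    where
    remainder≢0 : suc (q + q) % 2 ≢ 0
    remainder≢0 r≡0 with () ← trans (sym (trans (cong (_% 2) (cong suc (q+q≡q*2 q))) ([m+kn]%n≡m%n 1 q 2))) r≡0

  centre-partner : ∀ {s} → s < m → Kstar n m s < m × Reduces m (Kstar n m s + Kstar n m s) s
  centre-partner {s} s<m with halves s
  ... | even q rewrite kstar-centre-even q = ≤-<-trans (m≤m+n q q) s<m , inj₁ refl
  ... | odd q rewrite kstar-centre-odd q = s≤s (+-monoˡ-< k q<k) , inj₂ (centre-sum q k)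
    where
    q<k : q < k
    q<k = ≰⇒> (λ k≤q → <⇒≱ (s≤s⁻¹ s<m) (+-mono-≤ k≤q k≤q))

  kstar-meets : ∀ {t s} → t < n → s < m → Meet s t (Kstar n t s)
  kstar-meets {t} {s} t<n s<m with team-view t<n
  ... | inj₁ t<m = subst (Meet s t) (sym (kstar-rim t<m))
                     (rim-or-centre (m%n<n (s + m ∸ t) m) (rim-partner t<m s<m) (_ ≟ t))
    where
    rim-or-centre : ∀ {r} → r < m → Reduces m (t + r) s → (d : Dec (r ≡ t)) →
                    Meet s t (if ⌊ d ⌋ then m else r)
    rim-or-centre _ h (yes refl) = toCentre t<m h
    rim-or-centre r<m h (no r≢t) = rim t<m r<m r≢t h
  ... | inj₂ refl = fromCentre (proj₁ (centre-partner s<m)) (proj₂ (centre-partner s<m))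

  kstar-partner : ∀ {t o s} → t < n → s < m → Meet s t o → Kstar n t s ≡ o
  kstar-partner t<n s<m M = meet-functional (kstar-meets t<n s<m) M

  opp-reduces : ∀ {t s u} → u < m → Reduces m s u → opp n t s ≡ Kstar n t u
  opp-reduces u<m (inj₁ refl) = if-true (⌊⌋-true (_ <? m) u<m)
  opp-reduces {t} {u = u} u<m (inj₂ refl) =
    trans (if-false (⌊⌋-false (u + m <? m) (λ lt → <⇒≱ lt (m≤n+m m u)))) (cong (Kstar n t) (m+n∸n≡m u m))

  -- The home/away rule of Defs distinguishes low teams t < n/2 = k + 1, high
  -- rim teams k < t < m and the centre; these three lemmas select the branch.
  half-n : n / 2 ≡ suc k
  half-n = trans (cong (λ x → suc (suc x) / 2) (q+q≡q*2 k)) (m*n/n≡m (suc k) 2)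

  home-low : ∀ {t s} → t < suc k → home n t s ≡ ⌊ 2 * t ≤? s ⌋ ∧ ⌊ s ≤? k + k + 2 * t ⌋
  home-low {t} t≤k = if-true (⌊⌋-true (t <? n / 2) (subst (t <_) (sym half-n) t≤k))

  home-high : ∀ {t s} → suc k ≤ t → t ≢ m → home n t s ≡ not (⌊ 2 * t + 2 ∸ n ≤? s ⌋ ∧ ⌊ s ≤? 2 * t ⌋)
  home-high {t} k<t t≢m =
    trans (if-false (⌊⌋-false (t <? n / 2) (λ t<n/2 → <⇒≱ (subst (t <_) half-n t<n/2) k<t)))
          (if-false (⌊⌋-false (t ≟ m) t≢m))

  home-centre : ∀ {s} → home n m s ≡ ⌊ m ≤? s ⌋
  home-centre =
    trans (if-false (⌊⌋-false (m <? n / 2) (λ m<n/2 → <⇒≱ (subst (m <_) half-n m<n/2) (s≤s (m≤m+n k k)))))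
          (if-true (⌊⌋-true (m ≟ m) refl))

  low-double : ∀ {t} → t < suc k → 2 * t < m
  low-double {t} t≤k = s≤s (subst (_≤ k + k) (sym (double t)) (+-mono-≤ (s≤s⁻¹ t≤k) (s≤s⁻¹ t≤k)))

  high-double : ∀ {t} → suc k ≤ t → m < 2 * t
  high-double {t} k<t = subst₂ _≤_ (cong suc (+-suc k k)) (sym (double t)) (+-mono-≤ k<t k<t)

  -- The thresholds hidden in the home/away rule of Defs, in terms of m.
  low-threshold-to : ∀ {s x} → s + m ≤ k + k + x → s < x
  low-threshold-to {s} {x} le = +-cancelʳ-≤ (k + k) (suc s) x (subst₂ _≤_ (+-suc s (k + k)) (+-comm (k + k) x) le)

  low-threshold-from : ∀ {s x} → s < x → s + m ≤ k + k + x
  low-threshold-from {s} {x} lt = subst₂ _≤_ (sym (+-suc s (k + k))) (+-comm x (k + k)) (+-monoˡ-≤ (k + k) lt)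

  high-threshold-to : ∀ {t x} → 2 * t + 2 ∸ n ≤ x → 2 * t < x + m
  high-threshold-to {t} {x} le =
    subst (2 * t <_) (+-comm m x)
      (s≤s⁻¹ (subst (_≤ n + x) (+-comm (2 * t) 2) (≤-trans (m≤n+m∸n (2 * t + 2) n) (+-monoʳ-≤ n le))))

  high-threshold-from : ∀ {t x} → 2 * t < x + m → 2 * t + 2 ∸ n ≤ x
  high-threshold-from {t} {x} lt =
    m≤n+o⇒m∸n≤o (2 * t + 2) n (subst (_≤ n + x) (+-comm 2 (2 * t)) (s≤s (subst (2 * t <_) (+-comm x m) lt)))

  Away : ℕ → ℕ → Set
  Away t s = s < 2 * t × 2 * t < s + m

  away? : ∀ t s → Dec (Away t s)
  away? t s = (s <? 2 * t) ×-dec (2 * t <? s + m)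

  rim-home-first : ∀ {t s} → t < m → s < m → home n t s ≡ not ⌊ away? t s ⌋
  rim-home-first {t} {s} t<m s<m with t <? suc k
  ... | yes low = begin
    home n t s                               ≡⟨ home-low low ⟩
    ⌊ 2 * t ≤? s ⌋ ∧ ⌊ s ≤? k + k + 2 * t ⌋  ≡⟨ cong (⌊ 2 * t ≤? s ⌋ ∧_) (⌊⌋-true (s ≤? _) s≤k+k+2t) ⟩
    ⌊ 2 * t ≤? s ⌋ ∧ true                    ≡⟨ ∧-identityʳ _ ⟩
    ⌊ 2 * t ≤? s ⌋                           ≡⟨ ⌊⌋-complement (2 * t ≤? s) (away? t s)
                                                  (λ 2t≤s away → <⇒≱ (proj₁ away) 2t≤s)
                                                  (λ ¬away → ≮⇒≥ (λ s<2t → ¬away (s<2t , 2t<s+m))) ⟩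
    not ⌊ away? t s ⌋                        ∎
    where
    open ≡-Reasoning
    s≤k+k+2t : s ≤ k + k + 2 * t
    s≤k+k+2t = ≤-trans (s≤s⁻¹ s<m) (m≤m+n (k + k) (2 * t))
    2t<s+m : 2 * t < s + m
    2t<s+m = <-≤-trans (low-double low) (m≤n+m m s)
  ... | no ¬low = begin
    home n t s                                           ≡⟨ home-high (≮⇒≥ ¬low) (<⇒≢ t<m) ⟩
    not (⌊ 2 * t + 2 ∸ n ≤? s ⌋ ∧ ⌊ s ≤? 2 * t ⌋)        ≡⟨ cong (λ b → not (⌊ 2 * t + 2 ∸ n ≤? s ⌋ ∧ b)) (⌊⌋-true (s ≤? 2 * t) (<⇒≤ s<2t)) ⟩
    not (⌊ 2 * t + 2 ∸ n ≤? s ⌋ ∧ true)                  ≡⟨ cong not (∧-identityʳ _) ⟩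
    not ⌊ 2 * t + 2 ∸ n ≤? s ⌋                           ≡⟨ cong not (⌊⌋-iff (2 * t + 2 ∸ n ≤? s) (away? t s)
                                                              (λ le → s<2t , high-threshold-to {t} le)
                                                              (λ away → high-threshold-from {t} (proj₂ away))) ⟩
    not ⌊ away? t s ⌋                                    ∎
    where
    open ≡-Reasoning
    s<2t : s < 2 * t
    s<2t = <-trans s<m (high-double (≮⇒≥ ¬low))

  rim-home-second : ∀ {t s} → t < m → s < m → home n t (s + m) ≡ ⌊ away? t s ⌋
  rim-home-second {t} {s} t<m s<m with t <? suc k
  ... | yes low = begin
    home n t (s + m)                                   ≡⟨ home-low low ⟩
    ⌊ 2 * t ≤? s + m ⌋ ∧ ⌊ s + m ≤? k + k + 2 * t ⌋   ≡⟨ cong (_∧ ⌊ s + m ≤? k + k + 2 * t ⌋) (⌊⌋-true (2 * t ≤? s + m) (<⇒≤ 2t<s+m)) ⟩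
    ⌊ s + m ≤? k + k + 2 * t ⌋                         ≡⟨ ⌊⌋-iff (s + m ≤? k + k + 2 * t) (away? t s)
                                                            (λ le → low-threshold-to le , 2t<s+m)
                                                            (λ away → low-threshold-from (proj₁ away)) ⟩
    ⌊ away? t s ⌋                                      ∎
    where
    open ≡-Reasoning
    2t<s+m : 2 * t < s + m
    2t<s+m = <-≤-trans (low-double low) (m≤n+m m s)
  ... | no ¬low = begin
    home n t (s + m)                                     ≡⟨ home-high (≮⇒≥ ¬low) (<⇒≢ t<m) ⟩
    not (⌊ 2 * t + 2 ∸ n ≤? s + m ⌋ ∧ ⌊ s + m ≤? 2 * t ⌋) ≡⟨ cong (λ b → not (b ∧ ⌊ s + m ≤? 2 * t ⌋)) (⌊⌋-true (2 * t + 2 ∸ n ≤? s + m) (high-threshold-from {t} 2t<s+m+m)) ⟩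
    not ⌊ s + m ≤? 2 * t ⌋                               ≡⟨ sym (⌊⌋-complement (away? t s) (s + m ≤? 2 * t)
                                                              (λ away le → <⇒≱ (proj₂ away) le)
                                                              (λ ¬le → s<2t , ≰⇒> ¬le)) ⟩
    ⌊ away? t s ⌋                                        ∎
    where
    open ≡-Reasoning
    s<2t : s < 2 * t
    s<2t = <-trans s<m (high-double (≮⇒≥ ¬low))
    2t<s+m+m : 2 * t < s + m + m
    2t<s+m+m = <-≤-trans (subst (_< m + m) (sym (double t)) (+-mono-< t<m t<m)) (+-monoˡ-≤ m (m≤n+m m s))

  centre-home-first : ∀ {s} → s < m → home n m s ≡ false
  centre-home-first s<m = trans home-centre (⌊⌋-false (m ≤? _) (<⇒≱ s<m))

  centre-home-second : ∀ {s} → home n m (s + m) ≡ true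
  centre-home-second {s} = trans home-centre (⌊⌋-true (m ≤? s + m) (m≤n+m m s))

  home-second : ∀ {t s} → t < n → s < m → home n t (s + m) ≡ not (home n t s)
  home-second {t} {s} t<n s<m with team-view t<n
  ... | inj₁ t<m = trans (rim-home-second t<m s<m)
                         (trans (sym (not-involutive _)) (cong not (sym (rim-home-first t<m s<m))))
  ... | inj₂ refl = trans centre-home-second (sym (cong not (centre-home-first s<m)))

  rim-hosts : ∀ {t s} → t < m → s < m → ¬ Away t s → home n t s ≡ true
  rim-hosts {t} {s} t<m s<m ¬away = trans (rim-home-first t<m s<m) (cong not (⌊⌋-false (away? t s) ¬away))

  rim-visits : ∀ {t s} → t < m → s < m → Away t s → home n t s ≡ false
  rim-visits {t} {s} t<m s<m away = trans (rim-home-first t<m s<m) (cong not (⌊⌋-true (away? t s) away))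

  rim-away : ∀ {t o s} → t < o → o < m → Reduces m (t + o) s →
             (Away o s × ¬ Away t s) ⊎ (Away t s × ¬ Away o s)
  rim-away {t} {o} {s} t<o o<m (inj₁ t+o≡s) = inj₁ ((s<2o , 2o<s+m) , λ away → <⇒≱ (proj₁ away) 2t≤s)
    where
    2t≤s : 2 * t ≤ s
    2t≤s = subst₂ _≤_ (sym (double t)) t+o≡s (+-monoʳ-≤ t (<⇒≤ t<o))
    s<2o : s < 2 * o
    s<2o = subst₂ _<_ t+o≡s (sym (double o)) (+-monoˡ-< o t<o)
    2o<s+m : 2 * o < s + m
    2o<s+m = subst₂ _<_ (sym (double o)) (cong (_+ m) t+o≡s)
               (<-≤-trans (+-monoʳ-< o o<m) (+-monoˡ-≤ m (m≤n+m o t)))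
  rim-away {t} {o} {s} t<o o<m (inj₂ t+o≡s+m) = inj₂ ((s<2t , 2t<s+m) , λ away → <⇒≱ (proj₂ away) s+m≤2o)
    where
    s<t : s < t
    s<t = +-cancelʳ-< m s t (subst (_< t + m) t+o≡s+m (+-monoʳ-< t o<m))
    s<2t : s < 2 * t
    s<2t = <-≤-trans s<t (subst (t ≤_) (sym (double t)) (m≤m+n t t))
    2t<s+m : 2 * t < s + m
    2t<s+m = subst₂ _<_ (sym (double t)) t+o≡s+m (+-monoʳ-< t t<o)
    s+m≤2o : s + m ≤ 2 * o
    s+m≤2o = subst₂ _≤_ t+o≡s+m (sym (double o)) (+-monoˡ-≤ o (<⇒≤ t<o))

  centre-partner-hosts : ∀ {t s} → Reduces m (t + t) s → ¬ Away t s
  centre-partner-hosts {t} {s} (inj₁ t+t≡s) away = n≮n s (subst (s <_) (trans (double t) t+t≡s) (proj₁ away))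
  centre-partner-hosts {t} {s} (inj₂ t+t≡s+m) away = n≮n (s + m) (subst (_< s + m) (trans (double t) t+t≡s+m) (proj₂ away))

  rim-pair-differs : ∀ {t o s} → t < o → o < m → s < m → Reduces m (t + o) s → home n t s ≢ home n o s
  rim-pair-differs t<o o<m s<m h with rim-away t<o o<m h
  ... | inj₁ (away-o , ¬away-t) = opposite (rim-hosts (<-trans t<o o<m) s<m ¬away-t) (rim-visits o<m s<m away-o)
  ... | inj₂ (away-t , ¬away-o) = ≢-sym (opposite (rim-hosts o<m s<m ¬away-o) (rim-visits (<-trans t<o o<m) s<m away-t))

  home-differs-first : ∀ {s t o} → s < m → Meet s t o → home n t s ≢ home n o s
  home-differs-first {s} {t} {o} s<m (rim t<m o<m o≢t h) with <-cmp t o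
  ... | tri< t<o _ _ = rim-pair-differs t<o o<m s<m h
  ... | tri≈ _ t≡o _ = ⊥-elim (o≢t (sym t≡o))
  ... | tri> _ _ o<t = ≢-sym (rim-pair-differs o<t t<m s<m (subst (λ x → Reduces m x s) (+-comm t o) h))
  home-differs-first {t = t} s<m (toCentre t<m h) =
    opposite (rim-hosts t<m s<m (centre-partner-hosts {t} h)) (centre-home-first s<m)
  home-differs-first {o = o} s<m (fromCentre o<m h) =
    ≢-sym (opposite (rim-hosts o<m s<m (centre-partner-hosts {o} h)) (centre-home-first s<m))

  home-differs : ∀ {s u t o} → u < m → Reduces m s u → Meet u t o → home n t s ≢ home n o s
  home-differs u<m (inj₁ refl) M = home-differs-first u<m M
  home-differs {t = t} {o} u<m (inj₂ refl) M eq =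
    home-differs-first u<m M
      (not-injective (trans (sym (home-second t<n u<m)) (trans eq (home-second (meet-bound M) u<m))))
    where
    t<n : t < n
    t<n = meet-bound (meet-sym M)

  slot-count : 2 * n ∸ 2 ≡ m + m
  slot-count = trans (cong (k + k +_) (+-identityʳ n)) (+-suc (k + k) m)

  feasible : ∀ t s → t < n → s < 2 * n ∸ 2 →
    opp n t s < n × opp n t s ≢ t × opp n (opp n t s) s ≡ t × home n t s ≢ home n (opp n t s) s
  feasible t s t<n s<2n-2 with reduces-exists (subst (s <_) slot-count s<2n-2)
  ... | u , u<m , s↦u rewrite opp-reduces {t} u<m s↦u =
    meet-bound M , meet-irrefl M ,
    trans (opp-reduces {Kstar n t u} u<m s↦u) (kstar-partner (meet-bound M) u<m (meet-sym M)) ,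
    home-differs u<m s↦u M
    where
    M : Meet u t (Kstar n t u)
    M = kstar-meets t<n u<m

  meeting-slot : ∀ {i j s s₀} → i < n → s < 2 * n ∸ 2 → opp n i s ≡ j → s₀ < m → Meet s₀ i j → Reduces m s s₀
  meeting-slot {i} {j} {s} i<n s<2n-2 opp≡j s₀<m M₀ with reduces-exists (subst (s <_) slot-count s<2n-2)
  ... | u , u<m , s↦u = subst (Reduces m s) (meet-slot-unique u<m s₀<m M M₀) s↦u
    where
    M : Meet u i j
    M = subst (Meet u i) (trans (sym (opp-reduces {i} u<m s↦u)) opp≡j) (kstar-meets i<n u<m)

  host-slot : ∀ {j s₀} → j < n → s₀ < m →
    ∃[ s ] (Reduces m s s₀ × home n j s ≡ true × (∀ s′ → Reduces m s′ s₀ → home n j s′ ≡ true → s′ ≡ s))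
  host-slot {j} {s₀} j<n s₀<m with home n j s₀ in hosts-first
  ... | true = s₀ , inj₁ refl , hosts-first , only
    where
    only : ∀ s′ → Reduces m s′ s₀ → home n j s′ ≡ true → s′ ≡ s₀
    only _ (inj₁ refl) _ = refl
    only _ (inj₂ refl) hosts with () ← trans (sym hosts) (trans (home-second j<n s₀<m) (cong not hosts-first))
  ... | false = s₀ + m , inj₂ refl , trans (home-second j<n s₀<m) (cong not hosts-first) , only
    where
    only : ∀ s′ → Reduces m s′ s₀ → home n j s′ ≡ true → s′ ≡ s₀ + m
    only _ (inj₁ refl) hosts with () ← trans (sym hosts-first) hosts
    only _ (inj₂ refl) _ = refl

  visits-once : ∀ i j → i < n → j < n → i ≢ j →
    ∃[ s ] (s < 2 * n ∸ 2 × opp n i s ≡ j × home n j s ≡ true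
      × (∀ s′ → s′ < 2 * n ∸ 2 → opp n i s′ ≡ j → home n j s′ ≡ true → s′ ≡ s))
  visits-once i j i<n j<n i≢j with meet-exists i<n j<n i≢j
  ... | s₀ , s₀<m , M₀ with host-slot j<n s₀<m
  ...   | s , s↦s₀ , hosts , only =
    s ,
    subst (s <_) (sym slot-count) (reduces-bound s₀<m s↦s₀) ,
    trans (opp-reduces {i} s₀<m s↦s₀) (kstar-partner i<n s₀<m M₀) ,
    hosts ,
    λ s′ s′<2n-2 opp≡j hosts′ → only s′ (meeting-slot i<n s′<2n-2 opp≡j s₀<m M₀) hosts′

-- Since 2 ∣ n and n ≠ 0, n = 2k + 2 and the circle construction for k applies.
lemma2 : ∀ (n : ℕ) → 4 ≤ n → 2 ∣ n →
    (∀ t s → t < n → s < 2 * n ∸ 2 →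
        opp n t s < n × opp n t s ≢ t
      × opp n (opp n t s) s ≡ t
      × home n t s ≢ home n (opp n t s) s)
    × (∀ i j → i < n → j < n → i ≢ j →
        ∃[ s ] (s < 2 * n ∸ 2 × opp n i s ≡ j × home n j s ≡ true
          × (∀ s′ → s′ < 2 * n ∸ 2 → opp n i s′ ≡ j → home n j s′ ≡ true → s′ ≡ s)))
lemma2 _ () (divides zero refl)
lemma2 n _ (divides (suc k) n≡2k+2) rewrite trans n≡2k+2 (cong (λ x → suc (suc x)) (sym (q+q≡q*2 k))) =
  Circle.feasible k , Circle.visits-once k
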